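{- Let $T$ be an outbranching on an $n$-vertex set $V$ with root $\mathsf{root}$. For every $i\ge 1$ we have $\mathsf{root}\in R_i(T)\setminus L_{i+1}(T)$, $|L_i(T)|\ge|L_{i+1}(T)|$, and $|L_{i+1}(T)|\le\frac{n-|R_i(T)|}{i}$.
   Context: An outbranching is an out-tree (a rooted tree with all edges oriented away from the root) spanning $V$; a leaf of an out-tree is a vertex with outdegree $0$. The leaf layers are defined inductively: for $i\ge 1$, if $|V\setminus(L_1(T)\cup\dots\cup L_{i-1}(T))|>1$ then $L_i(T)$ is the set of leaves of the out-tree $T\setminus(L_1(T)\cup\dots\cup L_{i-1}(T))$, and otherwise $L_i(T)=\emptyset$. Further $R_i(T)=V\setminus(L_1(T)\cup\dots\cup L_i(T))$. -}

module Defs where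

open import Data.Nat using (ℕ; zero; suc; _<_)
open import Data.Nat.Properties using (_<?_)
open import Data.Bool using (Bool; true; false; _∧_; not; if_then_else_)
open import Data.Fin using (Fin)
open import Data.Fin.Subset using (Subset; _∪_; ∁; ⊥; ∣_∣)
open import Data.Vec using (lookup; tabulate)
open import Data.List using (allFin)
open import Data.Bool.ListAction using (any)
open import Data.Product using (Σ; _×_)
open import Relation.Nullary using (¬_)
open import Relation.Nullary.Decidable using (⌊_⌋)
open import Relation.Binary.PropositionalEquality using (_≡_)
open import Relation.Binary.Construct.Closure.ReflexiveTransitive using (Star)

Digraph : ℕ → Set
Digraph n = Fin n → Fin n → Bool

Arc : {n : ℕ} → Digraph n → Fin n → Fin n → Set
Arc A u v = A u v ≡ true

record IsOutBranching {n : ℕ} (A : Digraph n) (r : Fin n) : Set where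
  field
    root-in0    : ∀ u → A u r ≡ false
    nonroot-in1 : ∀ v → ¬ (v ≡ r) →
                  Σ (Fin n) λ u → Arc A u v × (∀ w → Arc A w v → w ≡ u)
    reachable   : ∀ v → Star (Arc A) r v

-- Leaves of the out-tree T \ (V \ S), i.e. of T restricted to the vertex set S:
-- vertices of S with no out-arc to a vertex of S.
leavesIn : {n : ℕ} → Digraph n → Subset n → Subset n
leavesIn {n} A S =
  tabulate λ v → lookup S v ∧ not (any (λ w → A v w ∧ lookup S w) (allFin n))

mutual
  U : {n : ℕ} → Digraph n → ℕ → Subset n
  U A zero    = ⊥
  U A (suc i) = U A i ∪ L A (suc i)

  -- Leaf layers L_i(T) (only meaningful for i ≥ 1; L 0 = ∅ is a dummy value).
  -- L_{i} = leaves of T \ (L_1 ∪ … ∪ L_{i-1}) if more than one vertex remains, else ∅.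
  L : {n : ℕ} → Digraph n → ℕ → Subset n
  L A zero    = ⊥
  L A (suc i) = if ⌊ 1 <? ∣ ∁ (U A i) ∣ ⌋ then leavesIn A (∁ (U A i)) else ⊥

R : {n : ℕ} → Digraph n → ℕ → Subset n
R A i = ∁ (U A i)

module Submission where

-- Let R_i be the vertices surviving the first i leaf layers and
-- U_i = L_1 ∪ … ∪ L_i its complement.
--  * Every R_i is closed under in-neighbours (a parent of a survivor survives,
--    because it is not a leaf while its child is still present).  In an
--    out-tree a closed set with at least two vertices has the root as a
--    non-leaf, so by induction the root is never peeled off: root ∈ R_i and
--    root ∉ L_{i+1}.
--  * Every y ∈ L_{j+2} was not a leaf of R_j, so it has a child in R_j, and that
--    child must lie in L_{j+1}.  Hence the parent map sends L_{j+1} onto a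
--    superset of L_{j+2}, and a function cannot enlarge a finite set:
--    |L_{j+2}| ≤ |L_{j+1}|.
--  * The layers are disjoint, so |U_j| + |L_{j+1}| ≤ |U_{j+1}|; together with
--    monotonicity of |L| an induction gives j·|L_{j+1}| ≤ |U_j| = n − |R_j|.

open import Defs
open import Data.Nat using (ℕ; zero; suc; _≤_; _<_; _*_; _∸_; _+_; z≤n; s≤s)
open import Data.Nat.Properties
  using (_<?_; ≤-trans; ≤-reflexive; +-mono-≤; +-monoʳ-≤; *-monoʳ-≤; +-comm; +-suc; n≤1+n;
         <-≤-trans; m∸[m∸n]≡n; module ≤-Reasoning)
open import Data.Bool using (Bool; true; false; _∧_; not)
open import Data.Bool.Properties using (T-≡; T-∧)
open import Data.Bool.ListAction using (any)
open import Data.Fin using (Fin; _≟_)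
import Data.Fin as Fin
open import Data.Fin.Subset using (Subset; _∈_; _∉_; ∣_∣; _∪_; ∁; ⁅_⁆; _⊆_; inside; outside)
import Data.Fin.Subset as Subset
open import Data.Fin.Subset.Properties
  using (∉⊥; ∣⊥∣≡0; x∈⁅x⁆; ∣⁅x⁆∣≡1; x∈∁p⇒x∉p; x∉∁p⇒x∈p; x∉p⇒x∈∁p; x∈p∪q⁻; x∈p∪q⁺;
         p⊆q⇒∣p∣≤∣q∣; ∣∁p∣≡n∸∣p∣; ∣p∣≤n)
open import Data.List using (allFin)
open import Data.List.Membership.Propositional using (lose)
open import Data.List.Membership.Propositional.Properties using (∈-allFin)
open import Data.List.Relation.Unary.Any using (satisfied)
open import Data.List.Relation.Unary.Any.Properties using (any⁺; any⁻)
open import Data.Product using (_×_; Σ; _,_; proj₁; proj₂)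
open import Data.Sum using (inj₁; inj₂; [_,_])
open import Data.Vec using (lookup; []; _∷_; here; there)
open import Data.Vec.Properties using (lookup∘tabulate; []=⇒lookup; lookup⇒[]=)
open import Data.Empty using (⊥-elim)
open import Function using (_∘_; Equivalence)
open import Relation.Nullary using (yes; no)
open import Relation.Binary.PropositionalEquality using (_≡_; refl; sym; trans; cong; cong₂; subst)
open import Relation.Binary.Construct.Closure.ReflexiveTransitive using (Star; ε; _◅_)
open Equivalence using (to; from)

∣p∪q∣≤∣p∣+∣q∣ : ∀ {n} (p q : Subset n) → ∣ p ∪ q ∣ ≤ ∣ p ∣ + ∣ q ∣
∣p∪q∣≤∣p∣+∣q∣ []           []           = z≤n
∣p∪q∣≤∣p∣+∣q∣ (inside ∷ p) (inside ∷ q) =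
  s≤s (≤-trans (∣p∪q∣≤∣p∣+∣q∣ p q) (+-monoʳ-≤ ∣ p ∣ (n≤1+n ∣ q ∣)))
∣p∪q∣≤∣p∣+∣q∣ (inside ∷ p)  (outside ∷ q) = s≤s (∣p∪q∣≤∣p∣+∣q∣ p q)
∣p∪q∣≤∣p∣+∣q∣ (outside ∷ p) (inside ∷ q)  =
  subst (suc ∣ p ∪ q ∣ ≤_) (sym (+-suc ∣ p ∣ ∣ q ∣)) (s≤s (∣p∪q∣≤∣p∣+∣q∣ p q))
∣p∪q∣≤∣p∣+∣q∣ (outside ∷ p) (outside ∷ q) = ∣p∪q∣≤∣p∣+∣q∣ p q

Disjoint : ∀ {n} → Subset n → Subset n → Set
Disjoint p q = ∀ {x} → x ∈ p → x ∉ q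

∣p∣+∣q∣≤∣p∪q∣ : ∀ {n} (p q : Subset n) → Disjoint p q → ∣ p ∣ + ∣ q ∣ ≤ ∣ p ∪ q ∣
∣p∣+∣q∣≤∣p∪q∣ []            []            _ = z≤n
∣p∣+∣q∣≤∣p∪q∣ (inside ∷ p)  (inside ∷ q)  d = ⊥-elim (d here here)
∣p∣+∣q∣≤∣p∪q∣ (inside ∷ p)  (outside ∷ q) d = s≤s (∣p∣+∣q∣≤∣p∪q∣ p q (λ x∈p x∈q → d (there x∈p) (there x∈q)))
∣p∣+∣q∣≤∣p∪q∣ (outside ∷ p) (inside ∷ q)  d =
  subst (_≤ suc ∣ p ∪ q ∣) (sym (+-suc ∣ p ∣ ∣ q ∣))
        (s≤s (∣p∣+∣q∣≤∣p∪q∣ p q (λ x∈p x∈q → d (there x∈p) (there x∈q))))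
∣p∣+∣q∣≤∣p∪q∣ (outside ∷ p) (outside ∷ q) d = ∣p∣+∣q∣≤∣p∪q∣ p q (λ x∈p x∈q → d (there x∈p) (there x∈q))

image : ∀ {m n} → (Fin m → Fin n) → Subset m → Subset n
image g []            = Subset.⊥
image g (inside ∷ p)  = ⁅ g Fin.zero ⁆ ∪ image (g ∘ Fin.suc) p
image g (outside ∷ p) = image (g ∘ Fin.suc) p

∈-image : ∀ {m n} (g : Fin m → Fin n) (p : Subset m) {x} → x ∈ p → g x ∈ image g p
∈-image g (inside ∷ p)  here        = x∈p∪q⁺ (inj₁ (x∈⁅x⁆ (g Fin.zero)))
∈-image g (inside ∷ p)  (there x∈p) = x∈p∪q⁺ (inj₂ (∈-image (g ∘ Fin.suc) p x∈p))
∈-image g (outside ∷ p) (there x∈p) = ∈-image (g ∘ Fin.suc) p x∈p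

∣image∣≤ : ∀ {m n} (g : Fin m → Fin n) (p : Subset m) → ∣ image g p ∣ ≤ ∣ p ∣
∣image∣≤ {n = n} g [] = ≤-reflexive (∣⊥∣≡0 n)
∣image∣≤ g (inside ∷ p) = begin
  ∣ ⁅ g Fin.zero ⁆ ∪ image (g ∘ Fin.suc) p ∣      ≤⟨ ∣p∪q∣≤∣p∣+∣q∣ ⁅ g Fin.zero ⁆ _ ⟩
  ∣ ⁅ g Fin.zero ⁆ ∣ + ∣ image (g ∘ Fin.suc) p ∣  ≡⟨ cong (_+ ∣ image (g ∘ Fin.suc) p ∣) (∣⁅x⁆∣≡1 (g Fin.zero)) ⟩
  suc ∣ image (g ∘ Fin.suc) p ∣                   ≤⟨ s≤s (∣image∣≤ (g ∘ Fin.suc) p) ⟩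
  suc ∣ p ∣                                       ∎
  where open ≤-Reasoning
∣image∣≤ g (outside ∷ p) = ∣image∣≤ (g ∘ Fin.suc) p

covered⇒∣q∣≤∣p∣ : ∀ {m n} (g : Fin m → Fin n) (p : Subset m) (q : Subset n) →
                  (∀ {y} → y ∈ q → Σ (Fin m) λ x → x ∈ p × g x ≡ y) → ∣ q ∣ ≤ ∣ p ∣
covered⇒∣q∣≤∣p∣ g p q cover = ≤-trans (p⊆q⇒∣p∣≤∣q∣ q⊆image) (∣image∣≤ g p)
  where
  q⊆image : q ⊆ image g p
  q⊆image y∈q with cover y∈q
  ... | x , x∈p , refl = ∈-image g p x∈p

∣p∣≡n∸∣∁p∣ : ∀ {n} (p : Subset n) → ∣ p ∣ ≡ n ∸ ∣ ∁ p ∣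
∣p∣≡n∸∣∁p∣ {n} p = trans (sym (m∸[m∸n]≡n (∣p∣≤n p))) (cong (n ∸_) (sym (∣∁p∣≡n∸∣p∣ p)))

module _ {n : ℕ} (A : Digraph n) (S : Subset n) where

  hasChildIn : Fin n → Bool
  hasChildIn v = any (λ w → A v w ∧ lookup S w) (allFin n)

  hasChildIn⇒ : ∀ {v} → hasChildIn v ≡ true → Σ (Fin n) λ w → Arc A v w × w ∈ S
  hasChildIn⇒ {v} c with satisfied (any⁻ _ (allFin n) (T-≡ .from c))
  ... | w , t with T-∧ .to t
  ...   | ta , ts = w , T-≡ .to ta , lookup⇒[]= w S (T-≡ .to ts)

  hasChildIn⇐ : ∀ {v w} → Arc A v w → w ∈ S → hasChildIn v ≡ true
  hasChildIn⇐ {w = w} a w∈S =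
    T-≡ .to (any⁺ _ (lose (∈-allFin w) (T-∧ .from (T-≡ .from a , T-≡ .from ([]=⇒lookup w∈S)))))

  private
    leaf-lookup : ∀ v → lookup (leavesIn A S) v ≡ lookup S v ∧ not (hasChildIn v)
    leaf-lookup v = lookup∘tabulate _ v

    ∧-not-true : ∀ {a b} → a ∧ not b ≡ true → a ≡ true × b ≡ false
    ∧-not-true {true} {false} _ = refl , refl

    leaf-bits : ∀ {v} → v ∈ leavesIn A S → lookup S v ≡ true × hasChildIn v ≡ false
    leaf-bits {v} v∈ = ∧-not-true (trans (sym (leaf-lookup v)) ([]=⇒lookup v∈))

  leaf-∈ : ∀ {v} → v ∈ leavesIn A S → v ∈ S
  leaf-∈ {v} v∈ = lookup⇒[]= v S (proj₁ (leaf-bits v∈))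

  leaf-childless : ∀ {v w} → v ∈ leavesIn A S → Arc A v w → w ∉ S
  leaf-childless v∈ a w∈S with trans (sym (hasChildIn⇐ a w∈S)) (proj₂ (leaf-bits v∈))
  ... | ()

  nonleaf-child : ∀ {v} → v ∈ S → v ∉ leavesIn A S → Σ (Fin n) λ w → Arc A v w × w ∈ S
  nonleaf-child {v} v∈S v∉ with hasChildIn v in c
  ... | true  = hasChildIn⇒ c
  ... | false = ⊥-elim (v∉ (lookup⇒[]= v _
                 (trans (leaf-lookup v) (cong₂ (λ a b → a ∧ not b) ([]=⇒lookup v∈S) c))))

module Layers {n : ℕ} (A : Digraph n) where

  L-suc⇒ : ∀ i {x} → x ∈ L A (suc i) → 1 < ∣ R A i ∣ × x ∈ leavesIn A (R A i)
  L-suc⇒ i x∈ with 1 <? ∣ ∁ (U A i) ∣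
  ... | yes big = big , x∈
  ... | no _    = ⊥-elim (∉⊥ x∈)

  L-suc⇐ : ∀ i {x} → 1 < ∣ R A i ∣ → x ∈ leavesIn A (R A i) → x ∈ L A (suc i)
  L-suc⇐ i big x∈ with 1 <? ∣ ∁ (U A i) ∣
  ... | yes _     = x∈
  ... | no small  = ⊥-elim (small big)

  L⊆R : ∀ i {x} → x ∈ L A (suc i) → x ∈ R A i
  L⊆R i x∈ = leaf-∈ A (R A i) (proj₂ (L-suc⇒ i x∈))

  R-suc⇒ : ∀ i {x} → x ∈ R A (suc i) → x ∈ R A i × x ∉ L A (suc i)
  R-suc⇒ i x∈ = x∉p⇒x∈∁p (x∉U ∘ x∈p∪q⁺ ∘ inj₁) , x∉U ∘ x∈p∪q⁺ ∘ inj₂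
    where x∉U = x∈∁p⇒x∉p x∈

  R-suc⇐ : ∀ i {x} → x ∈ R A i → x ∉ L A (suc i) → x ∈ R A (suc i)
  R-suc⇐ i x∈R x∉L = x∉p⇒x∈∁p λ x∈U → [ x∈∁p⇒x∉p x∈R , x∉L ] (x∈p∪q⁻ (U A i) (L A (suc i)) x∈U)

  R-suc⊆R : ∀ i {x} → x ∈ R A (suc i) → x ∈ R A i
  R-suc⊆R i = proj₁ ∘ R-suc⇒ i

  -- Each new layer is disjoint from the earlier ones, so U grows by |L_{i+1}|.
  U-growth : ∀ i → ∣ U A i ∣ + ∣ L A (suc i) ∣ ≤ ∣ U A (suc i) ∣
  U-growth i = ∣p∣+∣q∣≤∣p∪q∣ (U A i) (L A (suc i)) λ x∈U x∈L → x∈∁p⇒x∉p (L⊆R i x∈L) x∈U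

  InClosed : Subset n → Set
  InClosed S = ∀ {a b} → Arc A a b → b ∈ S → a ∈ S

  -- Peeling off leaves keeps the survivors in-closed: a parent of a survivor
  -- still has that child, so it is not a leaf and survives as well.
  R-inClosed : ∀ i → InClosed (R A i)
  R-inClosed zero    _  _   = x∉p⇒x∈∁p ∉⊥
  R-inClosed (suc i) ab b∈ = R-suc⇐ i a∈R a∉L
    where
    b∈R = R-suc⊆R i b∈
    a∈R = R-inClosed i ab b∈R
    a∉L = λ a∈L → leaf-childless A (R A i) (proj₂ (L-suc⇒ i a∈L)) ab b∈R

module Reachable {n : ℕ} (A : Digraph n) (root : Fin n)
                 (reachable : ∀ v → Star (Arc A) root v) where
  open Layers A

  path-into : ∀ {S a v} → InClosed S → Star (Arc A) a v → v ∈ S → a ∈ S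
  path-into closed ε        v∈ = v∈
  path-into closed (e ◅ p) v∈ = closed e (path-into closed p v∈)

  -- If the root is a leaf of an in-closed set S, then S ⊆ {root}: every other
  -- member would be reached through a child of the root lying in S.
  root-leaf⇒⊆⁅root⁆ : ∀ {S} → InClosed S → root ∈ leavesIn A S → S ⊆ ⁅ root ⁆
  root-leaf⇒⊆⁅root⁆ {S} closed leaf {v} v∈ = through (reachable v)
    where
    through : Star (Arc A) root v → v ∈ ⁅ root ⁆
    through ε       = x∈⁅x⁆ root
    through (e ◅ p) = ⊥-elim (leaf-childless A S leaf e (path-into closed p v∈))

  root-not-leaf : ∀ {S} → InClosed S → 1 < ∣ S ∣ → root ∉ leavesIn A S
  root-not-leaf closed big leaf with ≤-trans big (≤-trans (p⊆q⇒∣p∣≤∣q∣ (root-leaf⇒⊆⁅root⁆ closed leaf))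
                                                           (≤-reflexive (∣⁅x⁆∣≡1 root)))
  ... | s≤s ()

  root∉L : ∀ i → root ∉ L A (suc i)
  root∉L i r∈L with L-suc⇒ i r∈L
  ... | big , leaf = root-not-leaf (R-inClosed i) big leaf

  root∈R : ∀ i → root ∈ R A i
  root∈R zero    = x∉p⇒x∈∁p ∉⊥
  root∈R (suc i) = R-suc⇐ i (root∈R i) (root∉L i)

module Parented {n : ℕ} (A : Digraph n) (parent : Fin n → Fin n)
                (parent-arc : ∀ {u v} → Arc A u v → parent v ≡ u) where
  open Layers A

  -- Every leaf y of layer j+2 is the parent of some vertex of layer j+1:
  -- y was no leaf of R_j, and its child in R_j is absent from R_{j+1}.
  child-in-previous-layer : ∀ j {y} → y ∈ L A (suc (suc j)) →
                            Σ (Fin n) λ w → w ∈ L A (suc j) × parent w ≡ y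
  child-in-previous-layer j y∈ = w , w∈L , parent-arc yw
    where
    big      = proj₁ (L-suc⇒ (suc j) y∈)
    leaf     = proj₂ (L-suc⇒ (suc j) y∈)
    y∈R×y∉L  = R-suc⇒ j (leaf-∈ A _ leaf)
    bigR     = <-≤-trans big (p⊆q⇒∣p∣≤∣q∣ (R-suc⊆R j))
    y-child  = nonleaf-child A (R A j) (proj₁ y∈R×y∉L) (proj₂ y∈R×y∉L ∘ L-suc⇐ j bigR)
    w        = proj₁ y-child
    yw       = proj₁ (proj₂ y-child)
    w∈L : w ∈ L A (suc j)
    w∈L with x∈p∪q⁻ (U A j) (L A (suc j)) (x∉∁p⇒x∈p (leaf-childless A _ leaf yw))
    ... | inj₁ w∈U = ⊥-elim (x∈∁p⇒x∉p (proj₂ (proj₂ y-child)) w∈U)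
    ... | inj₂ w∈L = w∈L

  ∣L∣-mono : ∀ j → ∣ L A (suc (suc j)) ∣ ≤ ∣ L A (suc j) ∣
  ∣L∣-mono j = covered⇒∣q∣≤∣p∣ parent (L A (suc j)) (L A (suc (suc j))) (child-in-previous-layer j)

module _ {n : ℕ} {A : Digraph n} {root : Fin n} (ob : IsOutBranching A root) where
  open IsOutBranching ob

  parent : Fin n → Fin n
  parent v with v ≟ root
  ... | yes _    = root
  ... | no v≢r   = proj₁ (nonroot-in1 v v≢r)

  parent-arc : ∀ {u v} → Arc A u v → parent v ≡ u
  parent-arc {u} {v} uv with v ≟ root
  ... | yes refl with trans (sym (root-in0 u)) uv
  ...   | ()
  parent-arc {u} {v} uv | no v≢r = sym (proj₂ (proj₂ (nonroot-in1 v v≢r)) u uv)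

layer-bound : (ℓ u : ℕ → ℕ) → (∀ j → ℓ (suc (suc j)) ≤ ℓ (suc j)) →
              (∀ j → u j + ℓ (suc j) ≤ u (suc j)) → ∀ j → j * ℓ (suc j) ≤ u j
layer-bound ℓ u mono grow zero    = z≤n
layer-bound ℓ u mono grow (suc j) = begin
  ℓ (suc (suc j)) + j * ℓ (suc (suc j))  ≤⟨ +-mono-≤ (mono j) (*-monoʳ-≤ j (mono j)) ⟩
  ℓ (suc j) + j * ℓ (suc j)              ≤⟨ +-monoʳ-≤ (ℓ (suc j)) (layer-bound ℓ u mono grow j) ⟩
  ℓ (suc j) + u j                        ≡⟨ +-comm (ℓ (suc j)) (u j) ⟩
  u j + ℓ (suc j)                        ≤⟨ grow j ⟩
  u (suc j)                              ∎
  where open ≤-Reasoning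

lemma16 : (n : ℕ) (A : Digraph n) (root : Fin n) → IsOutBranching A root →
          (i : ℕ) → 1 ≤ i →
          (root ∈ R A i × root ∉ L A (suc i))
          × ∣ L A (suc i) ∣ ≤ ∣ L A i ∣
          × i * ∣ L A (suc i) ∣ ≤ n ∸ ∣ R A i ∣
lemma16 n A root ob (suc j) _ =
  (root∈R (suc j) , root∉L (suc j)) ,
  ∣L∣-mono j ,
  subst (suc j * ∣ L A (suc (suc j)) ∣ ≤_) (∣p∣≡n∸∣∁p∣ (U A (suc j)))
        (layer-bound (λ k → ∣ L A k ∣) (λ k → ∣ U A k ∣) ∣L∣-mono U-growth (suc j))
  where
  open Layers A
  open Reachable A root (IsOutBranching.reachable ob)
  open Parented A (parent ob) (parent-arc ob)
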